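{- Let $n$ be even. Then $n$ is a Zumkeller number if and only if either $n$ is a half-Zumkeller number, or $\frac{\sigma(n)-3n}{2}$ is $0$ or is a sum of distinct positive divisors of $n$ none of which equals $n$ or $\frac n2$.
   Context: $\sigma(n)$ denotes the sum of all positive divisors of $n$. A positive integer $n$ is a Zumkeller number if the set of all positive divisors of $n$ can be partitioned into two disjoint parts whose sums are equal. A positive integer $n$ is a half-Zumkeller number if the set of all positive divisors of $n$ other than $n$ itself can be partitioned into two disjoint parts whose sums are equal. -}

module Defs where

open import Data.Nat using (ℕ; suc; _/_)
open import Data.Nat.Divisibility using (_∣?_)
open import Data.Nat.Properties using (_≟_)
open import Data.List using (List; map; upTo; filter; filterᵇ)
open import Data.Nat.ListAction using (sum)
open import Data.List.Relation.Binary.Sublist.Propositional using (_⊆_)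
open import Data.Bool using (Bool; not)
open import Data.Product using (∃; _×_)
open import Relation.Binary.PropositionalEquality using (_≡_)
open import Relation.Nullary using (¬?)

divisors : ℕ → List ℕ
divisors n = filter (λ d → d ∣? n) (map suc (upTo n))

properDivisors : ℕ → List ℕ
properDivisors n = filter (λ d → ¬? (d ≟ n)) (divisors n)

σ : ℕ → ℕ
σ n = sum (divisors n)

-- A list (of distinct elements) can be split into two disjoint parts with equal
-- sums: the parts are given by a Boolean labelling f (true / false part).
EqualSumPartition : List ℕ → Set
EqualSumPartition xs =
  ∃ λ (f : ℕ → Bool) → sum (filterᵇ f xs) ≡ sum (filterᵇ (λ x → not (f x)) xs)

Zumkeller : ℕ → Set
Zumkeller n = EqualSumPartition (divisors n)

HalfZumkeller : ℕ → Set
HalfZumkeller n = EqualSumPartition (properDivisors n)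

divisorsExceptNAndHalf : ℕ → List ℕ
divisorsExceptNAndHalf n = filter (λ d → ¬? (d ≟ n / 2)) (properDivisors n)

-- k is a sum of distinct elements of the (duplicate-free) list xs:
-- k is the sum of some sublist of xs.
IsDistinctSumOf : List ℕ → ℕ → Set
IsDistinctSumOf xs k = ∃ λ (ys : List ℕ) → ys ⊆ xs × sum ys ≡ k

-- A labelling g : ℕ → Bool splits a list of divisors into the "true part" and
-- the "false part"; part g xs is the sum of the true part.  Let h = n / 2 and
-- let E be the divisors of n other than n and h.  Since the divisors are
-- distinct, every labelling decomposes as
--     part g D = [g n]·n + [g h]·h + part g E,   part g P = [g h]·h + part g E
-- (D all divisors, P the proper ones).  A balanced labelling of D may be
-- assumed to put n on the true side.  If it puts h on the false side, moving h
-- to the true side and forgetting n gives a balanced labelling of P, because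
-- n = 2h; if it puts h on the true side too, then σ(n) = 2(n + h + k) = 3n + 2k
-- where k is the sum of the true part of E.  Conversely both constructions can
-- be reversed by relabelling only n and h, since any sublist of a duplicate-free
-- list is the true part of some labelling.
module Submission where

open import Defs
open import Data.Nat using (ℕ; zero; suc; _+_; _*_; _<_; _/_; _≡ᵇ_; s≤s; z≤n)
open import Data.Nat.Divisibility using (_∣_; divides; _∣?_; ∣-refl; ∣⇒≤; 0∣⇒≡0)
open import Data.Nat.DivMod using (m*[n/m]≡n; m/n<m)
open import Data.Nat.Properties using (_≟_; +-assoc; +-cancelˡ-≡; +-commutativeSemigroup; suc-injective; <⇒≢; n>0⇒n≢0; ≡ᵇ⇒≡; ≡⇒≡ᵇ)
open import Data.Nat.Base using (>-nonZero)
open import Algebra.Properties.CommutativeSemigroup +-commutativeSemigroup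
  using () renaming (x∙yz≈y∙xz to +-left-swap)
open import Data.Nat.ListAction using (sum)
open import Data.Nat.Tactic.RingSolver using (solve-∀)
open import Data.Bool using (Bool; true; false; not; if_then_else_; T)
open import Data.Empty using (⊥-elim)
open import Data.Bool.Properties using (not-involutive)
open import Data.List using (List; []; _∷_; filter; filterᵇ)
open import Data.List.Properties using (filter-accept; filter-reject; filter-all)
open import Data.List.Membership.Propositional using (_∈_; _∉_)
open import Data.List.Membership.Propositional.Properties using (∈-filter⁺; ∈-filter⁻; ∈-map⁺; ∈-upTo⁺)
open import Data.List.Relation.Unary.Any using (here; there)
open import Data.List.Relation.Unary.All as All using ()
open import Data.List.Relation.Unary.All.Properties using (All¬⇒¬Any)
open import Data.List.Relation.Unary.AllPairs using (_∷_)
open import Data.List.Relation.Unary.Unique.Propositional using (Unique)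
import Data.List.Relation.Unary.Unique.Propositional.Properties as Unique
open import Data.List.Relation.Binary.Sublist.Propositional using (_⊆_; []; _∷_; _∷ʳ_; minimum)
open import Data.List.Relation.Binary.Sublist.Propositional.Properties using (filter-⊆)
open import Data.Product using (∃; _×_; _,_; proj₁; proj₂)
open import Data.Sum using (_⊎_; inj₁; inj₂)
open import Relation.Nullary using (¬?; contradiction)
open import Relation.Binary.PropositionalEquality
  using (_≡_; _≢_; refl; sym; trans; cong; cong₂; subst; ≢-sym; module ≡-Reasoning)
open import Function.Bundles using (_⇔_; mk⇔)

open ≡-Reasoning

pick : Bool → ℕ → ℕ
pick true  v = v
pick false _ = 0

part : (ℕ → Bool) → List ℕ → ℕ
part g xs = sum (filterᵇ g xs)

co : (ℕ → Bool) → ℕ → Bool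
co g x = not (g x)

Balanced : (ℕ → Bool) → List ℕ → Set
Balanced g xs = part g xs ≡ part (co g) xs

Agree : List ℕ → (ℕ → Bool) → (ℕ → Bool) → Set
Agree xs g g' = ∀ {x} → x ∈ xs → g x ≡ g' x

without : ℕ → List ℕ → List ℕ
without v = filter (λ d → ¬? (d ≟ v))

_[_↦_] : (ℕ → Bool) → ℕ → Bool → ℕ → Bool
(g [ v ↦ b ]) x = if x ≡ᵇ v then b else g x

part-∷ : ∀ g x xs → part g (x ∷ xs) ≡ pick (g x) x + part g xs
part-∷ g x xs with g x
... | true  = refl
... | false = refl

part-split : ∀ g xs → part g xs + part (co g) xs ≡ sum xs
part-split g [] = refl
part-split g (x ∷ xs) with g x
... | true  = trans (+-assoc x _ _) (cong (x +_) (part-split g xs))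
... | false = begin
  part g xs + (x + part (co g) xs)  ≡⟨ +-left-swap (part g xs) x _ ⟩
  x + (part g xs + part (co g) xs)  ≡⟨ cong (x +_) (part-split g xs) ⟩
  x + sum xs                        ∎

part-cong : ∀ {g g'} xs → Agree xs g g' → part g xs ≡ part g' xs
part-cong [] agree = refl
part-cong {g} {g'} (x ∷ xs) agree = begin
  part g (x ∷ xs)             ≡⟨ part-∷ g x xs ⟩
  pick (g x) x + part g xs    ≡⟨ cong₂ (λ b r → pick b x + r) (agree (here refl))
                                        (part-cong xs (λ m → agree (there m))) ⟩
  pick (g' x) x + part g' xs  ≡⟨ sym (part-∷ g' x xs) ⟩
  part g' (x ∷ xs)            ∎

co-agree : ∀ {xs g g'} → Agree xs g g' → Agree xs (co g) (co g')
co-agree agree m = cong not (agree m)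

balanced-co : ∀ {g} xs → Balanced g xs → Balanced (co g) xs
balanced-co {g} xs bal =
  trans (sym bal) (part-cong xs (λ {x} _ → sym (not-involutive (g x))))

put-on-true-side : ∀ xs v → EqualSumPartition xs →
                   ∃ λ g → g v ≡ true × Balanced g xs
put-on-true-side xs v (g , bal) with g v in gv
... | true  = g , gv , bal
... | false = co g , cong not gv , balanced-co xs bal

override-at : ∀ g v b → (g [ v ↦ b ]) v ≡ b
override-at g v b with v ≡ᵇ v in v≡ᵇv
... | true  = refl
... | false = ⊥-elim (subst T v≡ᵇv (≡⇒≡ᵇ v v refl))

override-elsewhere : ∀ g {v x} b → x ≢ v → (g [ v ↦ b ]) x ≡ g x
override-elsewhere g {v} {x} b x≢v with x ≡ᵇ v in x≡ᵇv
... | true  = contradiction (≡ᵇ⇒≡ x v (subst T (sym x≡ᵇv) _)) x≢v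
... | false = refl

override-agree : ∀ {xs} g {v} b → v ∉ xs → Agree xs (g [ v ↦ b ]) g
override-agree {xs} g b v∉xs m =
  override-elsewhere g b (λ x≡v → v∉xs (subst (_∈ xs) x≡v m))

head-∉ : ∀ {x : ℕ} {xs} → Unique (x ∷ xs) → x ∉ xs
head-∉ (x≢xs ∷ _) = All¬⇒¬Any x≢xs

without-∉ : ∀ v xs → v ∉ without v xs
without-∉ v xs m = proj₂ (∈-filter⁻ (λ d → ¬? (d ≟ v)) {xs = xs} m) refl

without-⊆ : ∀ {x} v xs → x ∈ without v xs → x ∈ xs
without-⊆ v xs m = proj₁ (∈-filter⁻ (λ d → ¬? (d ≟ v)) {xs = xs} m)

part-remove : ∀ g {v xs} → Unique xs → v ∈ xs →
              part g xs ≡ pick (g v) v + part g (without v xs)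
part-remove g {v} {v ∷ xs} (v≢xs ∷ _) (here refl) = begin
  part g (v ∷ xs)                             ≡⟨ part-∷ g v xs ⟩
  pick (g v) v + part g xs                    ≡⟨ cong (λ ys → pick (g v) v + part g ys) xs≡ ⟩
  pick (g v) v + part g (without v (v ∷ xs))  ∎
  where
  xs≡ : xs ≡ without v (v ∷ xs)
  xs≡ = sym (trans (filter-reject (λ d → ¬? (d ≟ v)) (λ v≢v → v≢v refl))
                   (filter-all (λ d → ¬? (d ≟ v)) (All.map ≢-sym v≢xs)))
part-remove g {v} {x ∷ xs} (x≢xs ∷ u) (there v∈xs) = begin
  part g (x ∷ xs)                                      ≡⟨ part-∷ g x xs ⟩
  pick (g x) x + part g xs                             ≡⟨ cong (pick (g x) x +_) (part-remove g u v∈xs) ⟩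
  pick (g x) x + (pick (g v) v + part g (without v xs)) ≡⟨ +-left-swap (pick (g x) x) (pick (g v) v) _ ⟩
  pick (g v) v + (pick (g x) x + part g (without v xs)) ≡⟨ cong (pick (g v) v +_) (sym (part-∷ g x (without v xs))) ⟩
  pick (g v) v + part g (x ∷ without v xs)             ≡⟨ cong (λ ys → pick (g v) v + part g ys) (sym keep-x) ⟩
  pick (g v) v + part g (without v (x ∷ xs))           ∎
  where
  keep-x : without v (x ∷ xs) ≡ x ∷ without v xs
  keep-x = filter-accept (λ d → ¬? (d ≟ v)) (All.lookup x≢xs v∈xs)

extend-labelling : ∀ {y xs s} b → Unique (y ∷ xs) → (∃ λ g → part g xs ≡ s) →
                   ∃ λ g → part g (y ∷ xs) ≡ pick b y + s
extend-labelling {y} {xs} {s} b u (g , part≡s) = g [ y ↦ b ] , (begin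
  part (g [ y ↦ b ]) (y ∷ xs)                      ≡⟨ part-∷ (g [ y ↦ b ]) y xs ⟩
  pick ((g [ y ↦ b ]) y) y + part (g [ y ↦ b ]) xs ≡⟨ cong₂ (λ c r → pick c y + r) (override-at g y b)
                                                        (part-cong xs (override-agree g b (head-∉ u))) ⟩
  pick b y + part g xs                             ≡⟨ cong (pick b y +_) part≡s ⟩
  pick b y + s                                     ∎)

sublist-part : ∀ {xs ys} → Unique xs → ys ⊆ xs → ∃ λ g → part g xs ≡ sum ys
sublist-part _ [] = (λ _ → false) , refl
sublist-part u@(_ ∷ u′) (y ∷ʳ ys⊆xs) = extend-labelling false u (sublist-part u′ ys⊆xs)
sublist-part u@(_ ∷ u′) (refl ∷ ys⊆xs) = extend-labelling true u (sublist-part u′ ys⊆xs)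

double-split : ∀ {n} h x → n ≡ 2 * h → n + x ≡ h + (h + x)
double-split h x refl = lemma h x
  where
  lemma : ∀ h x → 2 * h + x ≡ h + (h + x)
  lemma = solve-∀

-- A balanced labelling with n, h and the part k of E on the same side gives
-- σ(n) = 2(n + h + k) = 3n + 2k.
three-halves : ∀ {n} h k → n ≡ 2 * h → (n + (h + k)) + (n + (h + k)) ≡ 3 * n + 2 * k
three-halves h k refl = lemma h k
  where
  lemma : ∀ h k → (2 * h + (h + k)) + (2 * h + (h + k)) ≡ 3 * (2 * h) + 2 * k
  lemma = solve-∀

∈-divisors : ∀ {n d} → 0 < n → d ∣ n → d ∈ divisors n
∈-divisors {n} {zero} n>0 0∣n = contradiction (0∣⇒≡0 0∣n) (n>0⇒n≢0 n>0)
∈-divisors {n} {suc d} n>0 d∣n =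
  ∈-filter⁺ (_∣? n) (∈-map⁺ suc (∈-upTo⁺ (∣⇒≤ {{>-nonZero n>0}} d∣n))) d∣n

divisors-unique : ∀ n → Unique (divisors n)
divisors-unique n = Unique.filter⁺ (_∣? n) (Unique.map⁺ suc-injective (Unique.upTo⁺ n))

module EvenNumber (n : ℕ) (n>0 : 0 < n) (2∣n : 2 ∣ n) where

  h : ℕ
  h = n / 2

  n≡2h : n ≡ 2 * h
  n≡2h = sym (m*[n/m]≡n 2∣n)

  h≢n : h ≢ n
  h≢n = <⇒≢ (m/n<m n 2 {{>-nonZero n>0}} (s≤s (s≤s z≤n)))

  D P E : List ℕ
  D = divisors n
  P = properDivisors n
  E = divisorsExceptNAndHalf n

  D-unique : Unique D
  D-unique = divisors-unique n

  P-unique : Unique P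
  P-unique = Unique.filter⁺ (λ d → ¬? (d ≟ n)) D-unique

  E-unique : Unique E
  E-unique = Unique.filter⁺ (λ d → ¬? (d ≟ h)) P-unique

  n∈D : n ∈ D
  n∈D = ∈-divisors n>0 ∣-refl

  h∈P : h ∈ P
  h∈P = ∈-filter⁺ (λ d → ¬? (d ≟ n)) (∈-divisors n>0 (divides 2 n≡2h)) h≢n

  n∉E : n ∉ E
  n∉E n∈E = without-∉ n D (without-⊆ h P n∈E)

  h∉E : h ∉ E
  h∉E = without-∉ h P

  relabel : (ℕ → Bool) → Bool → Bool → ℕ → Bool
  relabel g a b = (g [ n ↦ a ]) [ h ↦ b ]

  relabel-n : ∀ g a b → relabel g a b n ≡ a
  relabel-n g a b = trans (override-elsewhere (g [ n ↦ a ]) b (≢-sym h≢n)) (override-at g n a)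

  relabel-h : ∀ g a b → relabel g a b h ≡ b
  relabel-h g a b = override-at (g [ n ↦ a ]) h b

  relabel-E : ∀ g a b → Agree E (relabel g a b) g
  relabel-E g a b m =
    trans (override-agree (g [ n ↦ a ]) b h∉E m) (override-agree g a n∉E m)

  part-P : ∀ g g' {b} → g h ≡ b → Agree E g g' → part g P ≡ pick b h + part g' E
  part-P g g' refl agree =
    trans (part-remove g P-unique h∈P) (cong (pick (g h) h +_) (part-cong E agree))

  part-D : ∀ g g' {a b} → g n ≡ a → g h ≡ b → Agree E g g' →
           part g D ≡ pick a n + (pick b h + part g' E)
  part-D g g' refl gh agree =
    trans (part-remove g D-unique n∈D) (cong (pick (g n) n +_) (part-P g g' gh agree))

  relabel-P : ∀ g a b → part (relabel g a b) P ≡ pick b h + part g E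
  relabel-P g a b = part-P _ g (relabel-h g a b) (relabel-E g a b)

  relabel-co-P : ∀ g a b → part (co (relabel g a b)) P ≡ pick (not b) h + part (co g) E
  relabel-co-P g a b = part-P _ (co g) (cong not (relabel-h g a b)) (co-agree (relabel-E g a b))

  relabel-D : ∀ g a b → part (relabel g a b) D ≡ pick a n + (pick b h + part g E)
  relabel-D g a b = part-D _ g (relabel-n g a b) (relabel-h g a b) (relabel-E g a b)

  relabel-co-D : ∀ g a b →
                 part (co (relabel g a b)) D ≡ pick (not a) n + (pick (not b) h + part (co g) E)
  relabel-co-D g a b =
    part-D _ (co g) (cong not (relabel-n g a b)) (cong not (relabel-h g a b)) (co-agree (relabel-E g a b))

  -- n and h on different sides: dropping n and moving h gives a half-Zumkeller
  -- partition, since n + X = h + Y with n = 2h means h + X = Y.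
  apart→half : ∀ {f} → f n ≡ true → f h ≡ false → Balanced f D → HalfZumkeller n
  apart→half {f} fn fh bal = g , (begin
    part g P                 ≡⟨ relabel-P f true true ⟩
    h + part f E             ≡⟨ +-cancelˡ-≡ h _ _ (trans (sym (double-split h _ n≡2h)) D-balance) ⟩
    part (co f) E            ≡⟨ sym (relabel-co-P f true true) ⟩
    part (co g) P            ∎)
    where
    g : ℕ → Bool
    g = relabel f true true
    D-balance : n + part f E ≡ h + part (co f) E
    D-balance = begin
      n + part f E       ≡⟨ sym (part-D f f fn fh (λ _ → refl)) ⟩
      part f D           ≡⟨ bal ⟩
      part (co f) D      ≡⟨ part-D (co f) (co f) (cong not fn) (cong not fh) (λ _ → refl) ⟩
      h + part (co f) E  ∎

  together→sum : ∀ {f} → f n ≡ true → f h ≡ true → Balanced f D →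
                 ∃ λ k → σ n ≡ 3 * n + 2 * k × (k ≡ 0 ⊎ IsDistinctSumOf E k)
  together→sum {f} fn fh bal =
    part f E , σ≡ , inj₂ (filterᵇ f E , filter-⊆ _ E , refl)
    where
    σ≡ : σ n ≡ 3 * n + 2 * part f E
    σ≡ = begin
      σ n                                          ≡⟨ sym (part-split f D) ⟩
      part f D + part (co f) D                     ≡⟨ cong (part f D +_) (sym bal) ⟩
      part f D + part f D                          ≡⟨ cong (λ s → s + s) (part-D f f fn fh (λ _ → refl)) ⟩
      (n + (h + part f E)) + (n + (h + part f E))  ≡⟨ three-halves h (part f E) n≡2h ⟩
      3 * n + 2 * part f E                         ∎

  -- A half-Zumkeller partition with h on the true side becomes a Zumkeller
  -- partition by putting n on the true side and h on the false side.
  half→zumkeller : HalfZumkeller n → Zumkeller n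
  half→zumkeller z with put-on-true-side P h z
  ... | g , gh , bal = f , (begin
    part f D           ≡⟨ relabel-D g true false ⟩
    n + part g E       ≡⟨ double-split h _ n≡2h ⟩
    h + (h + part g E) ≡⟨ cong (h +_) P-balance ⟩
    h + part (co g) E  ≡⟨ sym (relabel-co-D g true false) ⟩
    part (co f) D      ∎)
    where
    f : ℕ → Bool
    f = relabel g true false
    P-balance : h + part g E ≡ part (co g) E
    P-balance = begin
      h + part g E   ≡⟨ sym (part-P g g gh (λ _ → refl)) ⟩
      part g P       ≡⟨ bal ⟩
      part (co g) P  ≡⟨ part-P (co g) (co g) (cong not gh) (λ _ → refl) ⟩
      part (co g) E  ∎

  -- If σ(n) = 3n + 2k and k is the sum of a sublist of E, then n, h and that
  -- sublist together form half of σ(n).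
  sum→zumkeller : ∀ {k} → σ n ≡ 3 * n + 2 * k → IsDistinctSumOf E k → Zumkeller n
  sum→zumkeller {k} σ≡ (ys , ys⊆E , ys-sum) with sublist-part E-unique ys⊆E
  ... | g , g-sum = f , sym (+-cancelˡ-≡ (part f D) _ _ (begin
    part f D + part (co f) D       ≡⟨ part-split f D ⟩
    σ n                            ≡⟨ σ≡ ⟩
    3 * n + 2 * k                  ≡⟨ sym (three-halves h k n≡2h) ⟩
    (n + (h + k)) + (n + (h + k))  ≡⟨ cong (λ s → s + s) (sym part-f) ⟩
    part f D + part f D            ∎))
    where
    f : ℕ → Bool
    f = relabel g true true
    part-f : part f D ≡ n + (h + k)
    part-f = trans (relabel-D g true true)
                   (cong (λ s → n + (h + s)) (trans g-sum ys-sum))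

  zumkeller→criterion : Zumkeller n →
    HalfZumkeller n ⊎ (∃ λ k → σ n ≡ 3 * n + 2 * k × (k ≡ 0 ⊎ IsDistinctSumOf E k))
  zumkeller→criterion z with put-on-true-side D n z
  ... | f , fn , bal with f h in fh
  ...   | true  = inj₂ (together→sum fn fh bal)
  ...   | false = inj₁ (apart→half fn fh bal)

  criterion→zumkeller :
    HalfZumkeller n ⊎ (∃ λ k → σ n ≡ 3 * n + 2 * k × (k ≡ 0 ⊎ IsDistinctSumOf E k)) →
    Zumkeller n
  criterion→zumkeller (inj₁ z)                    = half→zumkeller z
  criterion→zumkeller (inj₂ (_ , σ≡ , inj₁ refl)) = sum→zumkeller σ≡ ([] , minimum E , refl)
  criterion→zumkeller (inj₂ (_ , σ≡ , inj₂ s))    = sum→zumkeller σ≡ s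

mainTheorem9 : (n : ℕ) → 0 < n → 2 ∣ n →
    Zumkeller n ⇔
      (HalfZumkeller n ⊎
        (∃ λ (k : ℕ) → σ n ≡ 3 * n + 2 * k
          × (k ≡ 0 ⊎ IsDistinctSumOf (divisorsExceptNAndHalf n) k)))
mainTheorem9 n n>0 2∣n = mk⇔ zumkeller→criterion criterion→zumkeller
  where open EvenNumber n n>0 2∣n
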